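{- Let $\sigma\le\tau$ and define $$C_1=\{\rho\in[\sigma,\tau] : \rho<\partial\tau,\ \rho\not\le\partial\tau\partial\},\qquad C_2=\{\rho\in[\sigma,\tau] : \rho<\tau\partial,\ \rho\not\le\partial\tau\partial\}.$$ Then $C_1$ and $C_2$ are chains, $C_1\cap C_2$ has at most one element, and if $z\in C_2\setminus C_1$ or $z\in C_1\setminus C_2$ then the interval $[z,\tau]$ is a chain.
   Context: Permutations are of $[d]=\{1,\dots,d\}$. The standard form of a sequence of distinct integers is the permutation order isomorphic to it. An occurrence of a consecutive pattern $\sigma$ in $\tau$ is a factor of consecutive letters of $\tau$ order isomorphic to $\sigma$. Permutations are partially ordered by $\sigma\le\tau$ iff $\sigma$ occurs as a consecutive pattern in $\tau$ ($<$ means $\le$ and $\neq$); $[x,y]=\{z: x\le z\le y\}$. For a permutation $\tau$: $\partial\tau$ is the standard form of $\tau$ with its first letter removed, $\tau\partial$ the standard form of $\tau$ with its last letter removed, and $\partial\tau\partial$ the standard form of $\tau$ with both its first and last letters removed. -}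

module Defs where

open import Data.Nat using (ℕ; suc; _∸_; _<?_)
open import Data.List using (List; map; length; drop; take; _++_; filter; upTo)
open import Data.List.Relation.Binary.Permutation.Propositional using (_↭_)
open import Data.Product using (Σ; ∃; _×_)
open import Data.Sum using (_⊎_)
open import Relation.Nullary using (¬_)
open import Relation.Binary.PropositionalEquality using (_≡_)

-- A permutation of [d] = {1,…,d} (d = length of the list), in one-line notation.
IsPerm : List ℕ → Set
IsPerm xs = xs ↭ map suc (upTo (length xs))

std : List ℕ → List ℕ
std xs = map (λ x → suc (length (filter (_<? x) xs))) xs

-- σ ≤ τ : σ occurs as a consecutive pattern (a factor) in τ.
_≼_ : List ℕ → List ℕ → Set
σ ≼ τ = Σ (List ℕ) λ as → Σ (List ℕ) λ ys → Σ (List ℕ) λ bs →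
          (τ ≡ as ++ ys ++ bs) × (std ys ≡ σ)

_≺_ : List ℕ → List ℕ → Set
σ ≺ τ = (σ ≼ τ) × ¬ (σ ≡ τ)

∂_ : List ℕ → List ℕ
∂ τ = std (drop 1 τ)

_∂ : List ℕ → List ℕ
τ ∂ = std (take (length τ ∸ 1) τ)

∂_∂ : List ℕ → List ℕ
∂ τ ∂ = std (take (length τ ∸ 2) (drop 1 τ))

InInterval : List ℕ → List ℕ → List ℕ → Set
InInterval x y z = IsPerm z × (x ≼ z) × (z ≼ y)

IsChain : (List ℕ → Set) → Set
IsChain P = ∀ ρ π → P ρ → P π → (ρ ≼ π) ⊎ (π ≼ ρ)

C₁ : List ℕ → List ℕ → List ℕ → Set
C₁ σ τ ρ = InInterval σ τ ρ × (ρ ≺ (∂ τ)) × ¬ (ρ ≼ (∂ τ ∂))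

C₂ : List ℕ → List ℕ → List ℕ → Set
C₂ σ τ ρ = InInterval σ τ ρ × (ρ ≺ (τ ∂)) × ¬ (ρ ≼ (∂ τ ∂))

module Submission where

-- Write τ = a · m · b, so that ∂τ, τ∂ and ∂τ∂ are the standard forms of
-- back = m·b, front = a·m and m.  The proof works with factors of words
-- rather than with patterns of standard forms:
--   * std is invariant under strictly monotone relabelling, hence
--     ρ ≤ std w iff ρ ≤ w, and consecutive containment is transitive;
--   * a pattern of m·b that does not occur in m is the standard form of a
--     suffix of m·b, and dually a pattern of a·m not in m comes from a prefix.
-- Hence C₁ consists of standard forms of suffixes of back and C₂ of standard
-- forms of prefixes of front; suffixes (prefixes) of one word are nested, so
-- both sets are chains.  Two elements of C₁ ∩ C₂ come from suffixes of the
-- same length, since a longer one would force the shorter one into m.  For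
-- z ∈ C₂ ∖ C₁, every ρ ∈ [z,τ] avoids back (else z ∈ C₁), so ρ comes from a
-- prefix of τ, and [z,τ] is a chain; symmetrically for z ∈ C₁ ∖ C₂.
-- Words of length < 2 have ∂τ = τ∂ = [] and the claims hold vacuously.

open import Defs
open import Data.Nat using (ℕ; suc; _<_; _≤_; _<?_; s≤s; z≤n)
open import Data.Nat.Properties
  using (<-≤-trans; <-trans; <⇒≤; m≤n⇒m≤1+n; <-irrefl; <-asym; <-cmp; ≤-trans)
open import Data.List using (List; []; _∷_; [_]; map; length; filter; drop; take; _++_; initLast; _∷ʳ′_)
open import Data.List.Properties
  using (map-++; length-map; filter-accept; filter-reject; ∷-injective; ∷-injectiveʳ; ∷ʳ-injectiveˡ;
         ++-assoc; ++-identityʳ; length-++-≤ˡ; length-++-≤ʳ; length-++-sucʳ; drop-map)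
open import Data.List.Membership.Propositional using (_∈_)
open import Data.List.Relation.Binary.Subset.Propositional using (_⊆_)
open import Data.List.Relation.Binary.Subset.Propositional.Properties using (⊆-refl; xs⊆ys++xs; xs⊆xs++ys)
open import Data.List.Relation.Unary.Any using (here; there)
open import Data.Product using (Σ; _×_; _,_; proj₂)
open import Data.Sum using (_⊎_; inj₁; inj₂)
open import Data.Empty using (⊥-elim)
open import Function using (_∘_)
open import Relation.Nullary using (¬_; yes; no)
open import Relation.Binary.PropositionalEquality hiding ([_])
open import Relation.Binary.Definitions using (tri<; tri≈; tri>)

smaller : ℕ → List ℕ → ℕ
smaller x w = length (filter (_<? x) w)

rank : List ℕ → ℕ → ℕ
rank w x = suc (smaller x w)

smaller-∷-< : ∀ {z x} w → z < x → smaller x (z ∷ w) ≡ suc (smaller x w)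
smaller-∷-< {z} {x} w z<x = cong length (filter-accept (_<? x) {z} {w} z<x)

smaller-∷-≮ : ∀ {z x} w → ¬ z < x → smaller x (z ∷ w) ≡ smaller x w
smaller-∷-≮ {z} {x} w z≮x = cong length (filter-reject (_<? x) {z} {w} z≮x)

smaller-mono : ∀ {x y} w → x ≤ y → smaller x w ≤ smaller y w
smaller-mono [] x≤y = z≤n
smaller-mono {x} {y} (z ∷ w) x≤y with z <? x | z <? y
... | yes p | yes q rewrite smaller-∷-< w p | smaller-∷-< w q = s≤s (smaller-mono w x≤y)
... | yes p | no q  = ⊥-elim (q (<-≤-trans p x≤y))
... | no p  | yes q rewrite smaller-∷-≮ w p | smaller-∷-< w q = m≤n⇒m≤1+n (smaller-mono w x≤y)
... | no p  | no q  rewrite smaller-∷-≮ w p | smaller-∷-≮ w q = smaller-mono w x≤y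

smaller-strict : ∀ {x y} w → x < y → x ∈ w → smaller x w < smaller y w
smaller-strict {x} {y} (z ∷ w) x<y (here refl) with z <? x | z <? y
... | yes p | _     = ⊥-elim (<-irrefl refl p)
... | no p  | yes q rewrite smaller-∷-≮ w p | smaller-∷-< w q = s≤s (smaller-mono w (<⇒≤ x<y))
... | no p  | no q  = ⊥-elim (q x<y)
smaller-strict {x} {y} (z ∷ w) x<y (there x∈w) with z <? x | z <? y
... | yes p | yes q rewrite smaller-∷-< w p | smaller-∷-< w q = s≤s (smaller-strict w x<y x∈w)
... | yes p | no q  = ⊥-elim (q (<-trans p x<y))
... | no p  | yes q rewrite smaller-∷-≮ w p | smaller-∷-< w q = m≤n⇒m≤1+n (smaller-strict w x<y x∈w)
... | no p  | no q  rewrite smaller-∷-≮ w p | smaller-∷-≮ w q = smaller-strict w x<y x∈w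

StrictMonoOn : (ℕ → ℕ) → List ℕ → Set
StrictMonoOn g ys = ∀ {x y} → x ∈ ys → y ∈ ys → x < y → g x < g y

rank-mono : ∀ w ys → ys ⊆ w → StrictMonoOn (rank w) ys
rank-mono w ys ys⊆w x∈ys _ x<y = s≤s (smaller-strict w x<y (ys⊆w x∈ys))

mono-reflects : ∀ g ys → StrictMonoOn g ys → ∀ {x y} → x ∈ ys → y ∈ ys → g x < g y → x < y
mono-reflects g ys mono {x} {y} x∈ys y∈ys gx<gy with <-cmp x y
... | tri< x<y _ _ = x<y
... | tri≈ _ refl _ = ⊥-elim (<-irrefl refl gx<gy)
... | tri> _ _ y<x = ⊥-elim (<-asym gx<gy (mono y∈ys x∈ys y<x))

smaller-map : ∀ g ys zs x → StrictMonoOn g ys → x ∈ ys → zs ⊆ ys →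
              smaller (g x) (map g zs) ≡ smaller x zs
smaller-map g ys [] x mono x∈ys zs⊆ys = refl
smaller-map g ys (z ∷ zs) x mono x∈ys zs⊆ys with g z <? g x | z <? x
... | yes p | yes q rewrite smaller-∷-< (map g zs) p | smaller-∷-< zs q =
  cong suc (smaller-map g ys zs x mono x∈ys (zs⊆ys ∘ there))
... | yes p | no q = ⊥-elim (q (mono-reflects g ys mono (zs⊆ys (here refl)) x∈ys p))
... | no p  | yes q = ⊥-elim (p (mono (zs⊆ys (here refl)) x∈ys q))
... | no p  | no q rewrite smaller-∷-≮ (map g zs) p | smaller-∷-≮ zs q =
  smaller-map g ys zs x mono x∈ys (zs⊆ys ∘ there)

std-map : ∀ g ys → StrictMonoOn g ys → std (map g ys) ≡ std ys
std-map g ys mono = ranks ys ⊆-refl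
  where
    ranks : ∀ zs → zs ⊆ ys → map (rank (map g ys)) (map g zs) ≡ map (rank ys) zs
    ranks [] _ = refl
    ranks (z ∷ zs) zs⊆ys =
      cong₂ _∷_ (cong suc (smaller-map g ys ys z mono (zs⊆ys (here refl)) ⊆-refl))
                (ranks zs (zs⊆ys ∘ there))

tail-⊆ : ∀ (w : List ℕ) → drop 1 w ⊆ w
tail-⊆ []      ()
tail-⊆ (x ∷ w) = there

∂-std : ∀ w → ∂ (std w) ≡ ∂ w
∂-std w = trans (cong std (drop-map 1 w)) (std-map (rank w) (drop 1 w) (rank-mono w (drop 1 w) (tail-⊆ w)))

Factor : List ℕ → List ℕ → Set
Factor u w = Σ (List ℕ) λ as → Σ (List ℕ) λ bs → w ≡ as ++ u ++ bs

factor-⊆ : ∀ {u w} → Factor u w → u ⊆ w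
factor-⊆ {u} (as , bs , refl) = xs⊆ys++xs (u ++ bs) as ∘ xs⊆xs++ys u bs

factor-trans : ∀ {u v w} → Factor u v → Factor v w → Factor u w
factor-trans {u} (cs , ds , refl) (as , bs , refl) = as ++ cs , ds ++ bs , regroup
  where
    open ≡-Reasoning
    regroup : as ++ (cs ++ u ++ ds) ++ bs ≡ (as ++ cs) ++ u ++ (ds ++ bs)
    regroup = begin
      as ++ (cs ++ u ++ ds) ++ bs ≡⟨ cong (as ++_) (++-assoc cs (u ++ ds) bs) ⟩
      as ++ cs ++ (u ++ ds) ++ bs ≡⟨ cong (λ t → as ++ cs ++ t) (++-assoc u ds bs) ⟩
      as ++ cs ++ u ++ ds ++ bs   ≡⟨ sym (++-assoc as cs _) ⟩
      (as ++ cs) ++ u ++ ds ++ bs ∎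

prefix-factor : ∀ u cs → Factor u (u ++ cs)
prefix-factor u cs = [] , cs , refl

suffix-factor : ∀ cs u → Factor u (cs ++ u)
suffix-factor cs u = cs , [] , cong (cs ++_) (sym (++-identityʳ u))

pattern-of-factor : ∀ {u w} → Factor u w → std u ≼ w
pattern-of-factor {u} (as , bs , eq) = as , u , bs , eq , refl

pattern-in-factor : ∀ {ρ u w} → ρ ≼ u → Factor u w → ρ ≼ w
pattern-in-factor (as , ys , bs , eq , st) u⊑w with factor-trans (as , bs , eq) u⊑w
... | cs , ds , eq′ = cs , ys , ds , eq′ , st

map-split : ∀ (f : ℕ → ℕ) v X Y → map f v ≡ X ++ Y →
  Σ (List ℕ) λ p → Σ (List ℕ) λ q → (v ≡ p ++ q) × (map f p ≡ X) × (map f q ≡ Y)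
map-split f v [] Y eq = [] , v , refl , refl , eq
map-split f [] (x ∷ X) Y ()
map-split f (a ∷ v) (x ∷ X) Y eq with ∷-injective eq
... | fa≡x , rest with map-split f v X Y rest
... | p , q , v≡pq , fp≡X , fq≡Y = a ∷ p , q , cong (a ∷_) v≡pq , cong₂ _∷_ fa≡x fp≡X , fq≡Y

to-std : ∀ {ρ w} → ρ ≼ w → ρ ≼ std w
to-std {w = w} (as , ys , bs , refl , refl) =
  map g as , map g ys , map g bs ,
  trans (map-++ g as (ys ++ bs)) (cong (map g as ++_) (map-++ g ys bs)) ,
  std-map g ys (rank-mono w ys (factor-⊆ (as , bs , refl)))
  where g = rank w

from-std : ∀ {ρ w} → ρ ≼ std w → ρ ≼ w
from-std {w = w} (as , ys , bs , eq , refl)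
  with map-split (rank w) w as (ys ++ bs) eq
... | p , r , w≡pr , _ , r-image with map-split (rank w) r ys bs r-image
... | u , s , r≡us , u-image , _ =
  p , u , s , trans w≡pr (cong (p ++_) r≡us) ,
  trans (sym (std-map (rank w) u (rank-mono w u (factor-⊆ (p , s , trans w≡pr (cong (p ++_) r≡us))))))
        (cong std u-image)

≼-trans : ∀ {ρ π w} → ρ ≼ π → π ≼ w → ρ ≼ w
≼-trans ρ≼π (as , ys , bs , eq , refl) = pattern-in-factor (from-std ρ≼π) (as , bs , eq)

tail-pattern : ∀ {ρ} x y → std x ≡ std y → ρ ≼ drop 1 x → ρ ≼ drop 1 y
tail-pattern {ρ} x y eq ρ≼x =
  from-std (subst (ρ ≼_) same-tail (to-std ρ≼x))
  where
    same-tail : ∂ x ≡ ∂ y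
    same-tail = trans (sym (∂-std x)) (trans (cong ∂_ eq) (∂-std y))

factor-of-full-length : ∀ (as ys bs : List ℕ) → length (as ++ ys ++ bs) ≡ length ys → as ++ ys ++ bs ≡ ys
factor-of-full-length [] ys [] _ = ++-identityʳ ys
factor-of-full-length [] ys (y ∷ bs) eq =
  ⊥-elim (<-irrefl (sym eq) (subst (length ys <_) (sym (length-++-sucʳ ys y bs)) (s≤s (length-++-≤ˡ ys))))
factor-of-full-length (x ∷ as) ys bs eq =
  ⊥-elim (<-irrefl (sym eq) (s≤s (≤-trans (length-++-≤ˡ ys) (length-++-≤ʳ (ys ++ bs) {as}))))

full-length-pattern : ∀ {ρ w} → ρ ≼ w → length ρ ≡ length w → ρ ≡ std w
full-length-pattern (as , ys , bs , refl , refl) len =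
  cong std (sym (factor-of-full-length as ys bs (sym (trans (sym (length-map (rank ys) ys)) len))))

strict-pattern-shorter : ∀ {ρ w} → ρ ≺ std w → ¬ length ρ ≡ length w
strict-pattern-shorter (ρ≼w , ρ≢w) len = ρ≢w (full-length-pattern (from-std ρ≼w) len)

PrefixPattern : List ℕ → List ℕ → Set
PrefixPattern w ρ = Σ (List ℕ) λ u → Σ (List ℕ) λ e → (w ≡ u ++ e) × (std u ≡ ρ)

SuffixPattern : List ℕ → List ℕ → Set
SuffixPattern w ρ = Σ (List ℕ) λ e → Σ (List ℕ) λ u → (w ≡ e ++ u) × (std u ≡ ρ)

factor-of-cons : ∀ a w as ys bs → a ∷ w ≡ as ++ ys ++ bs → as ≡ [] ⊎ Factor ys w
factor-of-cons a w []        ys bs eq = inj₁ refl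
factor-of-cons a w (x ∷ as) ys bs eq = inj₂ (as , bs , ∷-injectiveʳ eq)

factor-of-snoc : ∀ w b as ys bs → w ++ [ b ] ≡ as ++ ys ++ bs → bs ≡ [] ⊎ Factor ys w
factor-of-snoc w b as ys bs eq with initLast bs
... | []        = inj₁ refl
... | bs′ ∷ʳ′ y = inj₂ (as , bs′ , ∷ʳ-injectiveˡ w (as ++ ys ++ bs′) (trans eq regroup))
  where
    regroup : as ++ ys ++ bs′ ++ [ y ] ≡ (as ++ ys ++ bs′) ++ [ y ]
    regroup = trans (cong (as ++_) (sym (++-assoc ys bs′ [ y ]))) (sym (++-assoc as (ys ++ bs′) [ y ]))

new-pattern-of-cons : ∀ {ρ} a w → ρ ≼ (a ∷ w) → ¬ ρ ≼ w → PrefixPattern (a ∷ w) ρ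
new-pattern-of-cons a w (as , ys , bs , eq , st) ρ∉w with factor-of-cons a w as ys bs eq
... | inj₁ refl = ys , bs , eq , st
... | inj₂ ys⊑w = ⊥-elim (ρ∉w (subst (_≼ w) st (pattern-of-factor ys⊑w)))

new-pattern-of-snoc : ∀ {ρ} w b → ρ ≼ (w ++ [ b ]) → ¬ ρ ≼ w → SuffixPattern (w ++ [ b ]) ρ
new-pattern-of-snoc w b (as , ys , bs , eq , st) ρ∉w with factor-of-snoc w b as ys bs eq
... | inj₁ refl = as , ys , trans eq (cong (as ++_) (++-identityʳ ys)) , st
... | inj₂ ys⊑w = ⊥-elim (ρ∉w (subst (_≼ w) st (pattern-of-factor ys⊑w)))

prefixes-nested : ∀ (u₁ e₁ u₂ e₂ : List ℕ) → u₁ ++ e₁ ≡ u₂ ++ e₂ →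
  (Σ (List ℕ) λ cs → u₂ ≡ u₁ ++ cs) ⊎ (Σ (List ℕ) λ cs → u₁ ≡ u₂ ++ cs)
prefixes-nested []       e₁ u₂       e₂ eq = inj₁ (u₂ , refl)
prefixes-nested (x ∷ u₁) e₁ []       e₂ eq = inj₂ (x ∷ u₁ , refl)
prefixes-nested (x ∷ u₁) e₁ (y ∷ u₂) e₂ eq with ∷-injective eq
... | refl , eq′ with prefixes-nested u₁ e₁ u₂ e₂ eq′
... | inj₁ (cs , q) = inj₁ (cs , cong (x ∷_) q)
... | inj₂ (cs , q) = inj₂ (cs , cong (x ∷_) q)

suffixes-nested : ∀ (e₁ u₁ e₂ u₂ : List ℕ) → e₁ ++ u₁ ≡ e₂ ++ u₂ →
  (Σ (List ℕ) λ cs → u₂ ≡ cs ++ u₁) ⊎ (Σ (List ℕ) λ cs → u₁ ≡ cs ++ u₂)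
suffixes-nested []       u₁ e₂       u₂ eq = inj₂ (e₂ , eq)
suffixes-nested (x ∷ e₁) u₁ []       u₂ eq = inj₁ (x ∷ e₁ , sym eq)
suffixes-nested (x ∷ e₁) u₁ (y ∷ e₂) u₂ eq = suffixes-nested e₁ u₁ e₂ u₂ (∷-injectiveʳ eq)

prefix-patterns-chain : ∀ w → IsChain (PrefixPattern w)
prefix-patterns-chain w ρ π (u₁ , e₁ , eq₁ , refl) (u₂ , e₂ , eq₂ , refl)
  with prefixes-nested u₁ e₁ u₂ e₂ (trans (sym eq₁) eq₂)
... | inj₁ (cs , refl) = inj₁ (to-std (pattern-of-factor (prefix-factor u₁ cs)))
... | inj₂ (cs , refl) = inj₂ (to-std (pattern-of-factor (prefix-factor u₂ cs)))

suffix-patterns-chain : ∀ w → IsChain (SuffixPattern w)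
suffix-patterns-chain w ρ π (e₁ , u₁ , eq₁ , refl) (e₂ , u₂ , eq₂ , refl)
  with suffixes-nested e₁ u₁ e₂ u₂ (trans (sym eq₁) eq₂)
... | inj₁ (cs , refl) = inj₁ (to-std (pattern-of-factor (suffix-factor cs u₁)))
... | inj₂ (cs , refl) = inj₂ (to-std (pattern-of-factor (suffix-factor cs u₂)))

sub-chain : ∀ {P Q : List ℕ → Set} → (∀ ρ → P ρ → Q ρ) → IsChain Q → IsChain P
sub-chain P⊆Q chain ρ π Pρ Pπ = chain ρ π (P⊆Q ρ Pρ) (P⊆Q π Pπ)

-- If a prefix v of a·m has the standard form of c·cs·u, then the pattern of
-- u occurs in m: it sits in the tail of v, which lies inside m.
prefix-tail-factor : ∀ {a m} v e → a ∷ m ≡ v ++ e → Factor (drop 1 v) m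
prefix-tail-factor {m = m} []      e eq = [] , m , refl
prefix-tail-factor         (x ∷ v) e eq = [] , e , ∷-injectiveʳ eq

suffix-inside-prefix : ∀ {a m} c cs u v e → a ∷ m ≡ v ++ e → std v ≡ std (c ∷ cs ++ u) → std u ≼ m
suffix-inside-prefix c cs u v e eq st =
  pattern-in-factor (tail-pattern (c ∷ cs ++ u) v (sym st) (pattern-of-factor (suffix-factor cs u)))
                    (prefix-tail-factor v e eq)

Claims : List ℕ → List ℕ → Set
Claims σ τ = IsChain (C₁ σ τ) × IsChain (C₂ σ τ)
    × (∀ ρ π → C₁ σ τ ρ → C₂ σ τ ρ → C₁ σ τ π → C₂ σ τ π → ρ ≡ π)
    × (∀ z → ((C₂ σ τ z × ¬ C₁ σ τ z) ⊎ (C₁ σ τ z × ¬ C₂ σ τ z))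
         → IsChain (InInterval z τ))

no-strict-pattern-of-[] : ∀ {ρ} → ¬ ρ ≺ []
no-strict-pattern-of-[] (([] , [] , [] , refl , st) , ρ≢[]) = ρ≢[] (sym st)
no-strict-pattern-of-[] (([] , [] , _ ∷ _ , () , _) , _)
no-strict-pattern-of-[] (([] , _ ∷ _ , _ , () , _) , _)
no-strict-pattern-of-[] ((_ ∷ _ , _ , _ , () , _) , _)

short-word-claims : ∀ σ τ → ∂ τ ≡ [] → τ ∂ ≡ [] → Claims σ τ
short-word-claims σ τ ∂τ≡[] τ∂≡[] =
  (λ ρ _ c₁ _ → ⊥-elim (not-C₁ c₁)) , (λ ρ _ c₂ _ → ⊥-elim (not-C₂ c₂)) ,
  (λ ρ _ c₁ _ _ _ → ⊥-elim (not-C₁ c₁)) ,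
  (λ { z (inj₁ (c₂ , _)) → ⊥-elim (not-C₂ c₂) ; z (inj₂ (c₁ , _)) → ⊥-elim (not-C₁ c₁) })
  where
    not-C₁ : ∀ {ρ} → ¬ C₁ σ τ ρ
    not-C₁ {ρ} (_ , ρ≺∂τ , _) = no-strict-pattern-of-[] (subst (ρ ≺_) ∂τ≡[] ρ≺∂τ)
    not-C₂ : ∀ {ρ} → ¬ C₂ σ τ ρ
    not-C₂ {ρ} (_ , ρ≺τ∂ , _) = no-strict-pattern-of-[] (subst (ρ ≺_) τ∂≡[] ρ≺τ∂)

length-snoc : ∀ (m : List ℕ) b → length (m ++ [ b ]) ≡ suc (length m)
length-snoc []      b = refl
length-snoc (x ∷ m) b = cong suc (length-snoc m b)

take-init : ∀ (m : List ℕ) b → take (length m) (m ++ [ b ]) ≡ m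
take-init []      b = refl
take-init (x ∷ m) b = cong (x ∷_) (take-init m b)

module LongWord (σ : List ℕ) (a : ℕ) (m : List ℕ) (b : ℕ) where

  front back τ : List ℕ
  front = a ∷ m
  back  = m ++ [ b ]
  τ     = a ∷ back

  τ∂≡ : τ ∂ ≡ std front
  τ∂≡ rewrite length-snoc m b = cong (λ l → std (a ∷ l)) (take-init m b)

  ∂τ∂≡ : ∂ τ ∂ ≡ std m
  ∂τ∂≡ rewrite length-snoc m b = cong std (take-init m b)

  std-back-length : length (std back) ≡ length front
  std-back-length = trans (length-map (rank back) back) (length-snoc m b)

  std-front-length : length (std front) ≡ length back
  std-front-length = trans (length-map (rank front) front) (sym (length-snoc m b))

  avoids-middle : ∀ {ρ} → ¬ ρ ≼ ∂ τ ∂ → ¬ ρ ≼ m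
  avoids-middle {ρ} ρ∉ ρ≼m = ρ∉ (subst (ρ ≼_) (sym ∂τ∂≡) (to-std ρ≼m))

  C₁-suffix : ∀ ρ → C₁ σ τ ρ → SuffixPattern back ρ
  C₁-suffix ρ (_ , (ρ≼∂τ , _) , ρ∉) = new-pattern-of-snoc m b (from-std ρ≼∂τ) (avoids-middle ρ∉)

  C₂-prefix : ∀ ρ → C₂ σ τ ρ → PrefixPattern front ρ
  C₂-prefix ρ (_ , (ρ≼τ∂ , _) , ρ∉) =
    new-pattern-of-cons a m (from-std (subst (ρ ≼_) τ∂≡ ρ≼τ∂)) (avoids-middle ρ∉)

  -- An element of C₂ that also occurs in back lies in C₁, and vice versa;
  -- strictness is automatic since front and back have the same length.
  C₂-to-C₁ : ∀ {z} → C₂ σ τ z → z ≼ back → C₁ σ τ z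
  C₂-to-C₁ {z} (int , z≺τ∂ , z∉) z≼back = int , (to-std z≼back , z≢std-back) , z∉
    where
      z≢std-back : ¬ z ≡ std back
      z≢std-back refl = strict-pattern-shorter (subst (std back ≺_) τ∂≡ z≺τ∂) std-back-length

  C₁-to-C₂ : ∀ {z} → C₁ σ τ z → z ≼ front → C₂ σ τ z
  C₁-to-C₂ {z} (int , z≺∂τ , z∉) z≼front =
    int , (subst (z ≼_) (sym τ∂≡) (to-std z≼front) , z≢τ∂) , z∉
    where
      z≢τ∂ : ¬ z ≡ τ ∂
      z≢τ∂ z≡τ∂ = strict-pattern-shorter z≺∂τ (trans (cong length (trans z≡τ∂ τ∂≡)) std-front-length)

  -- Two common elements of C₁ and C₂ come from suffixes of equal length:
  -- a strictly longer suffix would push the shorter one into m.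
  longer-suffix : ∀ c cs u → C₂ σ τ (std (c ∷ cs ++ u)) → std u ≼ m
  longer-suffix c cs u c₂ with C₂-prefix _ c₂
  ... | v , e , eq , st = suffix-inside-prefix c cs u v e eq st

  intersection : ∀ ρ π → C₁ σ τ ρ → C₂ σ τ ρ → C₁ σ τ π → C₂ σ τ π → ρ ≡ π
  intersection ρ π c₁ρ c₂ρ c₁π c₂π with C₁-suffix ρ c₁ρ | C₁-suffix π c₁π
  ... | e₁ , u₁ , eq₁ , refl | e₂ , u₂ , eq₂ , refl with suffixes-nested e₁ u₁ e₂ u₂ (trans (sym eq₁) eq₂)
  ... | inj₁ ([] , refl)     = refl
  ... | inj₂ ([] , refl)     = refl
  ... | inj₁ (c ∷ cs , refl) = ⊥-elim (avoids-middle (proj₂ (proj₂ c₁ρ)) (longer-suffix c cs u₁ c₂π))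
  ... | inj₂ (c ∷ cs , refl) = ⊥-elim (avoids-middle (proj₂ (proj₂ c₁π)) (longer-suffix c cs u₂ c₂ρ))

  -- Above z ∈ C₂ ∖ C₁ everything avoids back, so comes from a prefix of τ;
  -- above z ∈ C₁ ∖ C₂ everything avoids front, so comes from a suffix of τ.
  interval-chain : ∀ z → ((C₂ σ τ z × ¬ C₁ σ τ z) ⊎ (C₁ σ τ z × ¬ C₂ σ τ z)) → IsChain (InInterval z τ)
  interval-chain z (inj₁ (c₂z , z∉C₁)) = sub-chain from-prefix (prefix-patterns-chain τ)
    where
      from-prefix : ∀ ρ → InInterval z τ ρ → PrefixPattern τ ρ
      from-prefix ρ (_ , z≼ρ , ρ≼τ) =
        new-pattern-of-cons a back ρ≼τ (λ ρ≼back → z∉C₁ (C₂-to-C₁ c₂z (≼-trans z≼ρ ρ≼back)))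
  interval-chain z (inj₂ (c₁z , z∉C₂)) = sub-chain from-suffix (suffix-patterns-chain τ)
    where
      from-suffix : ∀ ρ → InInterval z τ ρ → SuffixPattern τ ρ
      from-suffix ρ (_ , z≼ρ , ρ≼τ) =
        new-pattern-of-snoc front b ρ≼τ (λ ρ≼front → z∉C₂ (C₁-to-C₂ c₁z (≼-trans z≼ρ ρ≼front)))

  claims : Claims σ τ
  claims = sub-chain C₁-suffix (suffix-patterns-chain back) , sub-chain C₂-prefix (prefix-patterns-chain front) ,
           intersection , interval-chain

-- Lemma 3.3.
lemma3p3 : (σ τ : List ℕ) → IsPerm σ → IsPerm τ → σ ≼ τ →
    IsChain (C₁ σ τ) × IsChain (C₂ σ τ)
    × (∀ ρ π → C₁ σ τ ρ → C₂ σ τ ρ → C₁ σ τ π → C₂ σ τ π → ρ ≡ π)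
    × (∀ z → ((C₂ σ τ z × ¬ C₁ σ τ z) ⊎ (C₁ σ τ z × ¬ C₂ σ τ z))
         → IsChain (InInterval z τ))
lemma3p3 σ []         _ _ _ = short-word-claims σ [] refl refl
lemma3p3 σ (a ∷ rest) _ _ _ with initLast rest
... | []       = short-word-claims σ [ a ] refl refl
... | m ∷ʳ′ b  = LongWord.claims σ a m b
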